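{- There exist exactly two primitive PWR ideals of real quadratic fields whose lattices are similar to the hexagonal lattice $\mathcal H$, namely the ideals $(2,1+\sqrt3)$ and $(6,3+\sqrt3)$ of $\mathbb{Q}(\sqrt3)$.
   Context: The hexagonal lattice is $\mathcal H=\mathbb{Z}(1,0)\oplus\mathbb{Z}(1/2,\sqrt3/2)\subset\mathbb{R}^2$. For a real quadratic field $K=\mathbb{Q}(\sqrt d)$, $\Lambda(\alpha)=(\sigma_1(\alpha),\sigma_2(\alpha))$ with $\sigma_{1,2}(x+y\sqrt d)=x\pm y\sqrt d$. A lattice is well-rounded (WR) if its nonzero vectors of minimal length span $\mathbb{R}^2$; an ideal $I$ of $O_K$ is PWR if it is principal and $\Lambda(I)$ is WR. An integral ideal is primitive if it is not $mJ$ for an integral ideal $J$ and integer $m>1$. Lattices $L_1,L_2$ are similar if $L_2=\gamma UL_1$ with $\gamma>0$ and $U$ real orthogonal; an ideal is similar to a lattice if its image under $\Lambda$ is. -}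

module Defs where

open import Data.Nat as ℕ using (ℕ; zero; suc; _%_; _/_)
open import Data.Integer using (ℤ; +_; _+_; _*_; _-_; -_; _≤_; 0ℤ; 1ℤ)
open import Data.Product using (_×_; _,_; Σ; ∃; ∃-syntax)
open import Relation.Binary.PropositionalEquality using (_≡_; _≢_)
open import Relation.Nullary using (¬_)
open import Function.Bundles using (_⇔_)

SquareFree : ℕ → Set
SquareFree d = ∀ (m : ℕ) → (m ℕ.* m) Data.Nat.Divisibility.∣ d → m ≡ 1
  where import Data.Nat.Divisibility

-- Ring of integers O_K of K = ℚ(√d), d > 1 square-free, with ℤ-basis (1, ω):
--   ω = √d            if d ≢ 1 (mod 4)   (so ω² = d,           ω + ω̄ = 0)
--   ω = (1 + √d) / 2  if d ≡ 1 (mod 4)   (so ω² = (d-1)/4 + ω, ω + ω̄ = 1)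
-- ωP d , ωQ d  are such that ω² = ωP + ωQ · ω  (and ω + ω̄ = ωQ).
ωP : ℕ → ℤ
ωP d with d % 4
... | 1 = + (d / 4)
... | _ = + d

ωQ : ℕ → ℤ
ωQ d with d % 4
... | 1 = 1ℤ
... | _ = 0ℤ

-- An element x + y ω of O_K is represented by its coordinates (x , y).
OK : Set
OK = ℤ × ℤ

zeroO : OK
zeroO = (0ℤ , 0ℤ)

addO : OK → OK → OK
addO (x , y) (x' , y') = (x + x' , y + y')

scaleO : ℤ → OK → OK
scaleO m (x , y) = (m * x , m * y)

mulO : ℕ → OK → OK → OK
mulO d (x , y) (x' , y') =
  (x * x' + ωP d * (y * y') , x * y' + x' * y + ωQ d * (y * y'))

-- trace Tr(x + y ω) = σ₁ + σ₂ = 2x + ωQ·y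
trO : ℕ → OK → ℤ
trO d (x , y) = (+ 2) * x + ωQ d * y

-- Euclidean inner product  Λ(α) · Λ(β) = σ₁(α)σ₁(β) + σ₂(α)σ₂(β) = Tr(αβ)
inner : ℕ → OK → OK → ℤ
inner d α β = trO d (mulO d α β)

-- determinant of coordinates: nonzero iff α, β are ℝ-linearly independent
-- (Λ is an ℝ-linear isomorphism from (ℤ-coords ⊗ ℝ) to ℝ²)
detO : OK → OK → ℤ
detO (x , y) (x' , y') = x * y' - x' * y

Subset : Set₁
Subset = OK → Set

record IsIdeal (d : ℕ) (I : Subset) : Set where
  field
    has-zero : I zeroO
    add-closed : ∀ α β → I α → I β → I (addO α β)
    mul-closed : ∀ (r α : OK) → I α → I (mulO d r α)

_≈ˢ_ : Subset → Subset → Set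
I ≈ˢ J = ∀ α → I α ⇔ J α

Principal : ℕ → Subset → Set
Principal d I = ∃[ g ] (∀ α → I α ⇔ (∃[ r ] α ≡ mulO d g r))

scaleS : ℤ → Subset → Subset
scaleS m J α = ∃[ β ] (J β × α ≡ scaleO m β)

Primitive : ℕ → Subset → Set₁
Primitive d I = ¬ (∃[ m ] ∃[ J ] ((+ 2 ≤ m) × IsIdeal d J × (I ≈ˢ scaleS m J)))

MinimalVec : ℕ → Subset → OK → Set
MinimalVec d I u = I u × u ≢ zeroO ×
  (∀ α → I α → α ≢ zeroO → inner d u u ≤ inner d α α)

-- well-rounded: minimal vectors span ℝ² (i.e. two linearly independent ones)
WellRounded : ℕ → Subset → Set
WellRounded d I = ∃[ u ] ∃[ v ]
  (MinimalVec d I u × MinimalVec d I v × detO u v ≢ 0ℤ)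

PWR : ℕ → Subset → Set
PWR d I = Principal d I × WellRounded d I

IsBasis : ℕ → Subset → OK → OK → Set
IsBasis d I u v = I u × I v × detO u v ≢ 0ℤ ×
  (∀ α → I α → ∃[ m ] ∃[ n ] α ≡ addO (scaleO m u) (scaleO n v))

-- Λ(I) is similar to the hexagonal lattice H: Λ(I) has a basis whose Gram
-- matrix is a positive multiple of the Gram matrix [[1,1/2],[1/2,1]] of the
-- basis (1,0), (1/2,√3/2) of H (equivalent to Λ(I) = γ U H, γ > 0, U orthogonal).
SimilarToHex : ℕ → Subset → Set
SimilarToHex d I = ∃[ u ] ∃[ v ]
  (IsBasis d I u v × inner d u u ≡ inner d v v × inner d u u ≡ (+ 2) * inner d u v)

Gen2 : ℕ → OK → OK → Subset
Gen2 d g₁ g₂ α = ∃[ r ] ∃[ s ] α ≡ addO (mulO d r g₁) (mulO d s g₂)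

-- in Q(√3), ω = √3
-- (2, 1 + √3)
J₁ : Subset
J₁ = Gen2 3 (+ 2 , 0ℤ) (1ℤ , 1ℤ)

J₂ : Subset
J₂ = Gen2 3 (+ 6 , 0ℤ) (+ 3 , 1ℤ)

Good : ℕ → Subset → Set₁
Good d I = IsIdeal d I × Primitive d I × PWR d I × SimilarToHex d I

{-# OPTIONS --safe #-}
-- A ℤ-basis u, v of Λ(I) with hexagonal Gram matrix has ⟨u,u⟩ = ⟨v,v⟩ = 2⟨u,v⟩, so the
-- Gram determinant ⟨u,u⟩⟨v,v⟩ - ⟨u,v⟩² = disc(K) det(u,v)² gives 3⟨u,v⟩² = d (k det(u,v))²
-- with k ∈ {1, 2}; as 3 and d are squarefree, d = 3.  In ℤ[√3] the hexagonal conditions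
-- force, up to swapping u and v, u = (2e - b) + b√3 and v = (e - 2b) + e√3, a lattice of
-- index 2N where N = b² - be + e².  Closure of I under multiplication by √3 makes N divide
-- 3b², 3be and 3e², and primitivity makes b, e coprime, so N ∈ {1, 3}.  Solving for a basis
-- then gives I = (2, 1 + √3) when N = 1 and I = (6, 3 + √3) when N = 3 (then 3 ∣ b + e).
-- Conversely both ideals are principal, primitive and hexagonal, and hexagonal lattices are
-- well rounded.
module Submission where

open import Defs
open import Data.Empty using (⊥-elim)
open import Data.Integer.Base as ℤ
  using (ℤ; +_; -[1+_]; _+_; _*_; _-_; -_; 0ℤ; 1ℤ; ∣_∣; +≤+)
open import Data.Integer.Coprimality using (Coprime)
open import Data.Integer.Divisibility.Signed using (_∣_; divides; ∣ᵤ⇒∣; ∣⇒∣ᵤ)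
import Data.Integer.Properties as ℤP
open import Data.Integer.Tactic.RingSolver using (solve; solve-∀)
open import Data.List.Base using (List; _∷_; [])
open import Data.Nat.Base as ℕ using (ℕ; zero; suc; _<_; s≤s; z≤n; _%_; _/_)
import Data.Nat.Coprimality as ℕC
open import Data.Nat.DivMod using (m≡m%n+[m/n]*n; m/n*n≡m)
import Data.Nat.Divisibility as ℕ∣
open import Data.Nat.GCD using (gcd; gcd[m,n]∣m; gcd[m,n]∣n; gcd[m,n]≢0)
open import Data.Nat.Primality
  using (Prime; prime?; prime⇒irreducible; euclidsLemma; prime⇒nonZero; prime⇒nonTrivial)
import Data.Nat.Properties as ℕP
import Data.Nat.Tactic.RingSolver as ℕSolver
open import Data.Product using (_×_; _,_; proj₁; proj₂; ∃-syntax)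
open import Data.Product.Properties using (,-injectiveˡ)
open import Data.Sum using (_⊎_; inj₁; inj₂; [_,_]′)
open import Function.Base using (id)
open import Function.Bundles using (mk⇔; Equivalence)
open import Relation.Binary.PropositionalEquality hiding (J)
open import Relation.Nullary using (¬_)
open import Relation.Nullary.Decidable using (from-yes)

open import Algebra.Properties.CommutativeSemigroup ℤP.+-commutativeSemigroup using (interchange)

-- subst with the arguments swapped, so that an equation proved by solve is
-- elaborated after its left-hand side is known.
transport : ∀ {A : Set} (P : A → Set) {x y} → P x → x ≡ y → P y
transport _ Px refl = Px

linear-combination : ∀ {T U L R : ℤ} k → L ≡ R → T ≡ U + k * (L - R) → T ≡ U
linear-combination {U = U} {L} k refl T≡ = trans T≡ (cancel U k L)
  where
  cancel : ∀ U k L → U + k * (L - L) ≡ U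
  cancel = solve-∀

lin : ℤ → OK → ℤ → OK → OK
lin m (x , y) n (x' , y') = (m * x + n * x' , m * y + n * y')

hexForm : ℤ → ℤ → ℤ
hexForm m n = m * m + m * n + n * n

-- mulO d and inner d with ωP d, ωQ d abstracted to variables P, Q that the ring solver
-- can handle; under 𝒪 d below, mul and form are definitionally mulO d and inner d.
module QuadraticOrder (P Q : ℤ) where
  open ≡-Reasoning

  mul : OK → OK → OK
  mul (x , y) (x' , y') = (x * x' + P * (y * y') , x * y' + x' * y + Q * (y * y'))

  form : OK → OK → ℤ
  form (x , y) (x' , y') = + 2 * (x * x' + P * (y * y')) + Q * (x * y' + x' * y + Q * (y * y'))

  disc : ℤ
  disc = Q * Q + + 4 * P

  mul-comm : ∀ α β → mul α β ≡ mul β α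
  mul-comm (x , y) (x' , y') = cong₂ _,_ (solve vs) (solve vs)
    where
      vs : List ℤ
      vs = P ∷ Q ∷ x ∷ y ∷ x' ∷ y' ∷ []

  mul-assoc : ∀ α β γ → mul (mul α β) γ ≡ mul α (mul β γ)
  mul-assoc (x , y) (x' , y') (x'' , y'') = begin
    mul (x * x' + P * (y * y') , x * y' + x' * y + Q * (y * y')) (x'' , y'')
      ≡⟨ cong₂ _,_ (solve vs) (solve vs) ⟩
    mul (x , y) (x' * x'' + P * (y' * y'') , x' * y'' + x'' * y' + Q * (y' * y'')) ∎
    where
      vs : List ℤ
      vs = P ∷ Q ∷ x ∷ y ∷ x' ∷ y' ∷ x'' ∷ y'' ∷ []

  mul-distribˡ : ∀ α β γ → mul α (addO β γ) ≡ addO (mul α β) (mul α γ)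
  mul-distribˡ (x , y) (x' , y') (x'' , y'') = begin
    mul (x , y) (x' + x'' , y' + y'')
      ≡⟨ cong₂ _,_ (solve vs) (solve vs) ⟩
    addO (x * x' + P * (y * y') , x * y' + x' * y + Q * (y * y'))
         (x * x'' + P * (y * y'') , x * y'' + x'' * y + Q * (y * y'')) ∎
    where
      vs : List ℤ
      vs = P ∷ Q ∷ x ∷ y ∷ x' ∷ y' ∷ x'' ∷ y'' ∷ []

  mul-distribʳ : ∀ α β γ → mul (addO α β) γ ≡ addO (mul α γ) (mul β γ)
  mul-distribʳ α β γ = begin
    mul (addO α β) γ          ≡⟨ mul-comm (addO α β) γ ⟩
    mul γ (addO α β)          ≡⟨ mul-distribˡ γ α β ⟩
    addO (mul γ α) (mul γ β)  ≡⟨ cong₂ addO (mul-comm γ α) (mul-comm γ β) ⟩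
    addO (mul α γ) (mul β γ)  ∎

  mul-zeroˡ : ∀ α → mul zeroO α ≡ zeroO
  mul-zeroˡ (x , y) = begin
    mul (0ℤ , 0ℤ) (x , y) ≡⟨ cong₂ _,_ (solve vs) (solve vs) ⟩
    (0ℤ , 0ℤ)             ∎
    where
      vs : List ℤ
      vs = P ∷ Q ∷ x ∷ y ∷ []

  scale≡mul : ∀ m α → scaleO m α ≡ mul (m , 0ℤ) α
  scale≡mul m (x , y) = cong₂ _,_ (solve vs) (solve vs)
    where
      vs : List ℤ
      vs = P ∷ Q ∷ m ∷ x ∷ y ∷ []

  scale-mul : ∀ m α β → scaleO m (mul α β) ≡ mul α (scaleO m β)
  scale-mul m α β = begin
    scaleO m (mul α β)          ≡⟨ scale≡mul m (mul α β) ⟩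
    mul (m , 0ℤ) (mul α β)      ≡⟨ mul-assoc (m , 0ℤ) α β ⟨
    mul (mul (m , 0ℤ) α) β      ≡⟨ cong (λ γ → mul γ β) (mul-comm (m , 0ℤ) α) ⟩
    mul (mul α (m , 0ℤ)) β      ≡⟨ mul-assoc α (m , 0ℤ) β ⟩
    mul α (mul (m , 0ℤ) β)      ≡⟨ cong (mul α) (scale≡mul m β) ⟨
    mul α (scaleO m β)          ∎

  twice-form : ∀ x y → + 2 * form (x , y) (x , y) ≡ (+ 2 * x + Q * y) * (+ 2 * x + Q * y) + disc * (y * y)
  twice-form x y = begin
    + 2 * (+ 2 * (x * x + P * (y * y)) + Q * (x * y + x * y + Q * (y * y)))
      ≡⟨ solve (P ∷ Q ∷ x ∷ y ∷ []) ⟩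
    (+ 2 * x + Q * y) * (+ 2 * x + Q * y) + (Q * Q + + 4 * P) * (y * y) ∎

  form-lin : ∀ m n x y x' y' →
    form (lin m (x , y) n (x' , y')) (lin m (x , y) n (x' , y'))
      ≡ m * m * form (x , y) (x , y) + + 2 * (m * n) * form (x , y) (x' , y') + n * n * form (x' , y') (x' , y')
  form-lin m n x y x' y' = expanded P Q m n x y x' y'
    where
    expanded : ∀ P Q m n x y x' y' → let a = m * x + n * x' ; c = m * y + n * y' in
      + 2 * (a * a + P * (c * c)) + Q * (a * c + a * c + Q * (c * c))
        ≡ m * m * (+ 2 * (x * x + P * (y * y)) + Q * (x * y + x * y + Q * (y * y)))
          + + 2 * (m * n) * (+ 2 * (x * x' + P * (y * y')) + Q * (x * y' + x' * y + Q * (y * y')))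
          + n * n * (+ 2 * (x' * x' + P * (y' * y')) + Q * (x' * y' + x' * y' + Q * (y' * y')))
    expanded = solve-∀

  gram-det : ∀ x y x' y' →
    form (x , y) (x , y) * form (x' , y') (x' , y') - form (x , y) (x' , y') * form (x , y) (x' , y')
      ≡ disc * (detO (x , y) (x' , y') * detO (x , y) (x' , y'))
  gram-det x y x' y' = expanded P Q x y x' y'
    where
    expanded : ∀ P Q x y x' y' →
      (+ 2 * (x * x + P * (y * y)) + Q * (x * y + x * y + Q * (y * y)))
        * (+ 2 * (x' * x' + P * (y' * y')) + Q * (x' * y' + x' * y' + Q * (y' * y')))
      - (+ 2 * (x * x' + P * (y * y')) + Q * (x * y' + x' * y + Q * (y * y')))
        * (+ 2 * (x * x' + P * (y * y')) + Q * (x * y' + x' * y + Q * (y * y')))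
        ≡ (Q * Q + + 4 * P) * ((x * y' - x' * y) * (x * y' - x' * y))
    expanded = solve-∀

module 𝒪 (d : ℕ) = QuadraticOrder (ωP d) (ωQ d)

square≡ : ∀ i → i * i ≡ + (∣ i ∣ ℕ.* ∣ i ∣)
square≡ (+ n)    = ℤP.+◃n≡+n (n ℕ.* n)
square≡ -[1+ n ] = ℤP.+◃n≡+n (suc n ℕ.* suc n)

nonNeg-of-multiple : ∀ c {i k} → + suc c * i ≡ + k → 0ℤ ℤ.≤ i
nonNeg-of-multiple c {+ _}      _ = +≤+ z≤n
nonNeg-of-multiple c { -[1+ _ ]} ()

m*n≢1 : ∀ {m n} → + 2 ℤ.≤ m → m * n ≢ 1ℤ
m*n≢1 {+ k} {n} (+≤+ (s≤s (s≤s _))) m*n≡1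
  with ℕP.m*n≡1⇒m≡1 k ∣ n ∣ (trans (sym (ℤP.abs-* (+ k) n)) (cong ∣_∣ m*n≡1))
... | ()

Span : Subset → OK → OK → Set
Span I u v = ∀ α → I α → ∃[ m ] ∃[ n ] α ≡ lin m u n v

_⊆ˢ_ : Subset → Subset → Set
I ⊆ˢ J = ∀ α → I α → J α

⊆ˢ-antisym : ∀ {I J} → I ⊆ˢ J → J ⊆ˢ I → I ≈ˢ J
⊆ˢ-antisym I⊆J J⊆I α = mk⇔ (I⊆J α) (J⊆I α)

addO-identityˡ : ∀ α → addO zeroO α ≡ α
addO-identityˡ (x , y) = cong₂ _,_ (ℤP.+-identityˡ x) (ℤP.+-identityˡ y)

addO-interchange : ∀ α β γ δ → addO (addO α β) (addO γ δ) ≡ addO (addO α γ) (addO β δ)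
addO-interchange (x , y) (x' , y') (x'' , y'') (x''' , y''') =
  cong₂ _,_ (interchange x x' x'' x''') (interchange y y' y'' y''')

scaleO-zero : ∀ m → scaleO m zeroO ≡ zeroO
scaleO-zero m = cong₂ _,_ (ℤP.*-zeroʳ m) (ℤP.*-zeroʳ m)

scaleO-distrib : ∀ m α β → scaleO m (addO α β) ≡ addO (scaleO m α) (scaleO m β)
scaleO-distrib m (x , y) (x' , y') = cong₂ _,_ (ℤP.*-distribˡ-+ m x x') (ℤP.*-distribˡ-+ m y y')

module _ {d I} (isI : IsIdeal d I) where
  open IsIdeal isI

  ideal-scale : ∀ m {α} → I α → I (scaleO m α)
  ideal-scale m {α} Iα = transport I (mul-closed (m , 0ℤ) α Iα) (sym (𝒪.scale≡mul d m α))

  ideal-lin : ∀ m n {u v} → I u → I v → I (lin m u n v)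
  ideal-lin m n Iu Iv = add-closed _ _ (ideal-scale m Iu) (ideal-scale n Iv)

  span⊆ideal : ∀ {J u v} → Span J u v → I u → I v → J ⊆ˢ I
  span⊆ideal span Iu Iv α Jα with span α Jα
  ... | m , n , refl = ideal-lin m n Iu Iv

Gen2-isIdeal : ∀ d g₁ g₂ → IsIdeal d (Gen2 d g₁ g₂)
Gen2-isIdeal d g₁ g₂ = record
  { has-zero   = zeroO , zeroO , sym (cong₂ addO (mul-zeroˡ g₁) (mul-zeroˡ g₂))
  ; add-closed = λ { _ _ (r , s , refl) (r' , s' , refl) →
      addO r r' , addO s s' ,
      trans (addO-interchange (mulO d r g₁) (mulO d s g₂) (mulO d r' g₁) (mulO d s' g₂))
            (sym (cong₂ addO (mul-distribʳ r r' g₁) (mul-distribʳ s s' g₂))) }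
  ; mul-closed = λ { t _ (r , s , refl) →
      mulO d t r , mulO d t s ,
      trans (mul-distribˡ t (mulO d r g₁) (mulO d s g₂))
            (sym (cong₂ addO (mul-assoc t r g₁) (mul-assoc t s g₂))) }
  }
  where open 𝒪 d

Gen2-principal : ∀ d g₁ g k → g₁ ≡ mulO d g k → Principal d (Gen2 d g₁ g)
Gen2-principal d _ g k refl = g , λ α → mk⇔ to from
  where
  open 𝒪 d
  open ≡-Reasoning
  to : ∀ {α} → Gen2 d (mulO d g k) g α → ∃[ r ] α ≡ mulO d g r
  to (r , s , refl) = addO (mulO d k r) s , (begin
    addO (mulO d r (mulO d g k)) (mulO d s g)
      ≡⟨ cong₂ addO (trans (mul-comm r (mulO d g k)) (mul-assoc g k r)) (mul-comm s g) ⟩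
    addO (mulO d g (mulO d k r)) (mulO d g s)
      ≡⟨ mul-distribˡ g (mulO d k r) s ⟨
    mulO d g (addO (mulO d k r) s) ∎)
  from : ∀ {α} → ∃[ r ] α ≡ mulO d g r → Gen2 d (mulO d g k) g α
  from (r , refl) = zeroO , r , (begin
    mulO d g r                                    ≡⟨ mul-comm g r ⟩
    mulO d r g                                    ≡⟨ addO-identityˡ _ ⟨
    addO zeroO (mulO d r g)                       ≡⟨ cong (λ z → addO z (mulO d r g)) (mul-zeroˡ (mulO d g k)) ⟨
    addO (mulO d zeroO (mulO d g k)) (mulO d r g) ∎)

-- I = m J for the ideal J = {β | m β ∈ I}.
multiples⇒¬primitive : ∀ {d I m} → IsIdeal d I → + 2 ℤ.≤ m
  → (∀ α → I α → ∃[ β ] α ≡ scaleO m β) → ¬ Primitive d I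
multiples⇒¬primitive {d} {I} {m} isI 2≤m divisible I-primitive =
  I-primitive (m , J , 2≤m , J-isIdeal , I≈mJ)
  where
  open IsIdeal isI
  J : Subset
  J β = I (scaleO m β)
  J-isIdeal : IsIdeal d J
  J-isIdeal = record
    { has-zero   = transport I has-zero (sym (scaleO-zero m))
    ; add-closed = λ α β Jα Jβ → transport I (add-closed _ _ Jα Jβ) (sym (scaleO-distrib m α β))
    ; mul-closed = λ r β Jβ → transport I (mul-closed r _ Jβ) (sym (𝒪.scale-mul d m r β))
    }
  I≈mJ : I ≈ˢ scaleS m J
  I≈mJ = ⊆ˢ-antisym
    (λ α Iα → let (β , α≡mβ) = divisible α Iα in β , transport I Iα α≡mβ , α≡mβ)
    (λ { _ (β , Jβ , refl) → Jβ })

∋[x,1]⇒primitive : ∀ {d I x} → I (x , 1ℤ) → Primitive d I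
∋[x,1]⇒primitive {x = x} I∋ (m , J , 2≤m , _ , I≈mJ)
  with Equivalence.to (I≈mJ (x , 1ℤ)) I∋
... | _ , _ , x,1≡mβ = m*n≢1 2≤m (sym (cong proj₂ x,1≡mβ))

-- Hexagonal Gram matrices

twice-hexForm : ∀ m n
  → + 2 * hexForm m n ≡ + (∣ m ∣ ℕ.* ∣ m ∣ ℕ.+ ∣ n ∣ ℕ.* ∣ n ∣ ℕ.+ ∣ m + n ∣ ℕ.* ∣ m + n ∣)
twice-hexForm m n = begin
  + 2 * (m * m + m * n + n * n)     ≡⟨ solve (m ∷ n ∷ []) ⟩
  m * m + n * n + (m + n) * (m + n) ≡⟨ cong₂ _+_ (cong₂ _+_ (square≡ m) (square≡ n)) (square≡ (m + n)) ⟩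
  _                                 ∎
  where open ≡-Reasoning

hexForm-nonNeg : ∀ m n → 0ℤ ℤ.≤ hexForm m n
hexForm-nonNeg m n = nonNeg-of-multiple 1 (twice-hexForm m n)

hexForm-pos : ∀ m n → ¬ (m ≡ 0ℤ × n ≡ 0ℤ) → 1ℤ ℤ.≤ hexForm m n
hexForm-pos m n m,n≢0 with hexForm m n | twice-hexForm m n
... | + suc _  | _ = +≤+ (s≤s z≤n)
... | -[1+ _ ] | ()
... | + zero   | 0≡sum = ⊥-elim (m,n≢0 (square≡0 m |m|²≡0 , square≡0 n |n|²≡0))
  where
  |m|²+|n|²≡0 : ∣ m ∣ ℕ.* ∣ m ∣ ℕ.+ ∣ n ∣ ℕ.* ∣ n ∣ ≡ 0
  |m|²+|n|²≡0 = ℕP.m+n≡0⇒m≡0 _ (sym (ℤP.+-injective 0≡sum))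
  |m|²≡0 : ∣ m ∣ ℕ.* ∣ m ∣ ≡ 0
  |m|²≡0 = ℕP.m+n≡0⇒m≡0 _ |m|²+|n|²≡0
  |n|²≡0 : ∣ n ∣ ℕ.* ∣ n ∣ ≡ 0
  |n|²≡0 = ℕP.m+n≡0⇒n≡0 (∣ m ∣ ℕ.* ∣ m ∣) |m|²+|n|²≡0
  square≡0 : ∀ i → ∣ i ∣ ℕ.* ∣ i ∣ ≡ 0 → i ≡ 0ℤ
  square≡0 i |i|²≡0 = ℤP.∣i∣≡0⇒i≡0 ([ id , id ]′ (ℕP.m*n≡0⇒m≡0∨n≡0 ∣ i ∣ |i|²≡0))

ω-cases : ∀ d → (d % 4 ≡ 1 × ωP d ≡ + (d / 4) × ωQ d ≡ 1ℤ) ⊎ (ωP d ≡ + d × ωQ d ≡ 0ℤ)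
ω-cases d with d % 4
... | 0           = inj₂ (refl , refl)
... | 1           = inj₁ (refl , refl , refl)
... | suc (suc _) = inj₂ (refl , refl)

disc≡d*square : ∀ d → ∃[ k ] (k ≢ 0 × 𝒪.disc d ≡ + (d ℕ.* (k ℕ.* k)))
disc≡d*square d with ω-cases d
... | inj₁ (d%4≡1 , P≡ , Q≡) = 1 , (λ ()) , (begin
  ωQ d * ωQ d + + 4 * ωP d    ≡⟨ cong₂ (λ p q → q * q + + 4 * p) P≡ Q≡ ⟩
  1ℤ + + 4 * + (d / 4)        ≡⟨ cong (λ z → 1ℤ + z) (ℤP.pos-* 4 (d / 4)) ⟨
  + (1 ℕ.+ 4 ℕ.* (d / 4))     ≡⟨ cong +_ d≡1+4[d/4] ⟨
  + d                         ≡⟨ cong +_ (ℕP.*-identityʳ d) ⟨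
  + (d ℕ.* 1)                 ∎)
  where
  open ≡-Reasoning
  d≡1+4[d/4] : d ≡ 1 ℕ.+ 4 ℕ.* (d / 4)
  d≡1+4[d/4] = trans (m≡m%n+[m/n]*n d 4) (cong₂ ℕ._+_ d%4≡1 (ℕP.*-comm (d / 4) 4))
... | inj₂ (P≡ , Q≡) = 2 , (λ ()) , (begin
  ωQ d * ωQ d + + 4 * ωP d    ≡⟨ cong₂ (λ p q → q * q + + 4 * p) P≡ Q≡ ⟩
  0ℤ + + 4 * + d              ≡⟨ ℤP.+-identityˡ _ ⟩
  + 4 * + d                   ≡⟨ ℤP.pos-* 4 d ⟨
  + (4 ℕ.* d)                 ≡⟨ cong +_ (ℕP.*-comm 4 d) ⟩
  + (d ℕ.* 4)                 ∎)
  where open ≡-Reasoning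

inner-nonNeg : ∀ d α → 0ℤ ℤ.≤ inner d α α
inner-nonNeg d α@(x , y) with disc≡d*square d
... | k , _ , disc≡ = nonNeg-of-multiple 1 (begin
  + 2 * inner d α α                               ≡⟨ 𝒪.twice-form d x y ⟩
  t * t + 𝒪.disc d * (y * y)                      ≡⟨ cong₂ _+_ (square≡ t) (cong₂ _*_ disc≡ (square≡ y)) ⟩
  + (∣ t ∣ ℕ.* ∣ t ∣) + + D * + (∣ y ∣ ℕ.* ∣ y ∣) ≡⟨ cong (λ z → + (∣ t ∣ ℕ.* ∣ t ∣) + z) (ℤP.pos-* D _) ⟨
  _                                               ∎)
  where
  open ≡-Reasoning
  t : ℤ
  t = trO d α
  D : ℕ
  D = d ℕ.* (k ℕ.* k)

detO-zeroˡ : ∀ v → detO zeroO v ≡ 0ℤ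
detO-zeroˡ (x , y) = begin
  0ℤ * y - x * 0ℤ ≡⟨ solve (x ∷ y ∷ []) ⟩
  0ℤ              ∎
  where open ≡-Reasoning

detO-zeroʳ : ∀ u → detO u zeroO ≡ 0ℤ
detO-zeroʳ (x , y) = begin
  x * 0ℤ - 0ℤ * y ≡⟨ solve (x ∷ y ∷ []) ⟩
  0ℤ              ∎
  where open ≡-Reasoning

hexGram-quadratic : ∀ {A B C} m n → A ≡ B → A ≡ + 2 * C
  → m * m * A + + 2 * (m * n) * C + n * n * B ≡ A * (m * m + m * n + n * n)
hexGram-quadratic {A} {B} {C} m n A≡B A≡2C =
  linear-combination (- (n * n)) A≡B (linear-combination (- (m * n)) A≡2C (solve (A ∷ B ∷ C ∷ m ∷ n ∷ [])))

hexGram-det : ∀ {A B C} → A ≡ B → A ≡ + 2 * C → + 3 * (C * C) ≡ A * B - C * C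
hexGram-det {A} {B} {C} A≡B A≡2C =
  linear-combination A A≡B (linear-combination (- (A + + 2 * C)) A≡2C (solve (A ∷ B ∷ C ∷ [])))

similarToHex⇒wellRounded : ∀ {d I} → SimilarToHex d I → WellRounded d I
similarToHex⇒wellRounded {d} {I} (u@(x , y) , v@(x' , y') , (Iu , Iv , det≢0 , span) , |u|≡|v| , |u|≡2⟨u,v⟩) =
  u , v , (Iu , u≢0 , minimal) ,
  (Iv , v≢0 , λ α Iα α≢0 → subst (ℤ._≤ inner d α α) |u|≡|v| (minimal α Iα α≢0)) , det≢0
  where
  open ℤP.≤-Reasoning
  u≢0 : u ≢ zeroO
  u≢0 refl = det≢0 (detO-zeroˡ v)
  v≢0 : v ≢ zeroO
  v≢0 refl = det≢0 (detO-zeroʳ u)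
  k : ℤ
  k = inner d u u
  instance
    k-nonNeg : ℤ.NonNegative k
    k-nonNeg = ℤ.nonNegative (inner-nonNeg d u)
  minimal : ∀ α → I α → α ≢ zeroO → k ℤ.≤ inner d α α
  minimal α Iα α≢0 with span α Iα
  ... | m , n , refl = begin
    k                ≡⟨ ℤP.*-identityʳ k ⟨
    k * 1ℤ           ≤⟨ ℤP.*-monoˡ-≤-nonNeg k (hexForm-pos m n λ { (refl , refl) → α≢0 refl }) ⟩
    k * hexForm m n  ≡⟨ hexGram-quadratic m n |u|≡|v| |u|≡2⟨u,v⟩ ⟨
    m * m * k + + 2 * (m * n) * inner d u v + n * n * inner d v v
                     ≡⟨ 𝒪.form-lin d m n x y x' y' ⟨
    inner d (lin m u n v) (lin m u n v) ∎

-- Squarefreeness forces d = 3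

coprime-*ˡ : ∀ {m n o} → ℕC.Coprime m o → ℕC.Coprime n o → ℕC.Coprime (m ℕ.* n) o
coprime-*ˡ {m} m⊥o n⊥o (i∣mn , i∣o) = n⊥o (ℕC.coprime-divisor i⊥m i∣mn , i∣o)
  where
  i⊥m : ℕC.Coprime _ m
  i⊥m (j∣i , j∣m) = m⊥o (j∣m , ℕ∣.∣-trans j∣i i∣o)

coprime-squares : ∀ {m n} → ℕC.Coprime m n → ℕC.Coprime (m ℕ.* m) (n ℕ.* n)
coprime-squares {m} {n} m⊥n = ℕC.sym (coprime-*ˡ n⊥mm n⊥mm)
  where
  n⊥mm : ℕC.Coprime n (m ℕ.* m)
  n⊥mm = ℕC.sym (coprime-*ˡ m⊥n m⊥n)

coprime-square-divisor : ∀ {a b c e} → ℕC.Coprime c e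
  → a ℕ.* (c ℕ.* c) ≡ b ℕ.* (e ℕ.* e) → (e ℕ.* e) ℕ∣.∣ a
coprime-square-divisor {a} {b} {c} c⊥e eq =
  ℕC.coprime-divisor (ℕC.sym (coprime-squares c⊥e))
    (ℕ∣.divides b (trans (ℕP.*-comm (c ℕ.* c) a) eq))

cancel-square : ∀ {a b c e} g .{{_ : ℕ.NonZero g}}
  → a ℕ.* ((c ℕ.* g) ℕ.* (c ℕ.* g)) ≡ b ℕ.* ((e ℕ.* g) ℕ.* (e ℕ.* g))
  → a ℕ.* (c ℕ.* c) ≡ b ℕ.* (e ℕ.* e)
cancel-square {a} {b} {c} {e} g eq =
  ℕP.*-cancelʳ-≡ _ _ (g ℕ.* g) {{ℕP.m*n≢0 g g}} (trans (regroup a c g) (trans eq (sym (regroup b e g))))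
  where
  regroup : ∀ a c g → a ℕ.* (c ℕ.* c) ℕ.* (g ℕ.* g) ≡ a ℕ.* ((c ℕ.* g) ℕ.* (c ℕ.* g))
  regroup = ℕSolver.solve-∀

-- Cancelling gcd(c, e) reduces to coprime c, e, where e² ∣ a and c² ∣ b.
squareFree-unique : ∀ {a b} c {e} → SquareFree a → SquareFree b → e ≢ 0
  → a ℕ.* (c ℕ.* c) ≡ b ℕ.* (e ℕ.* e) → a ≡ b
squareFree-unique {a} {b} c {e} sf-a sf-b e≢0 eq = begin
  a                     ≡⟨ ℕP.*-identityʳ a ⟨
  a ℕ.* (1 ℕ.* 1)       ≡⟨ cong (λ z → a ℕ.* (z ℕ.* z)) c₀≡1 ⟨
  a ℕ.* (c₀ ℕ.* c₀)     ≡⟨ eq₀ ⟩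
  b ℕ.* (e₀ ℕ.* e₀)     ≡⟨ cong (λ z → b ℕ.* (z ℕ.* z)) e₀≡1 ⟩
  b ℕ.* (1 ℕ.* 1)       ≡⟨ ℕP.*-identityʳ b ⟩
  b                     ∎
  where
  open ≡-Reasoning
  g : ℕ
  g = gcd c e
  instance
    g≢0 : ℕ.NonZero g
    g≢0 = ℕ.≢-nonZero (gcd[m,n]≢0 c e (inj₂ e≢0))
  c₀ e₀ : ℕ
  c₀ = c / g
  e₀ = e / g
  eq₀ : a ℕ.* (c₀ ℕ.* c₀) ≡ b ℕ.* (e₀ ℕ.* e₀)
  eq₀ = cancel-square {a} {b} {c₀} {e₀} g (subst₂ (λ c e → a ℕ.* (c ℕ.* c) ≡ b ℕ.* (e ℕ.* e))
          (sym (m/n*n≡m (gcd[m,n]∣m c e))) (sym (m/n*n≡m (gcd[m,n]∣n c e))) eq)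
  c₀⊥e₀ : ℕC.Coprime c₀ e₀
  c₀⊥e₀ = ℕC.coprime-/gcd c e
  e₀≡1 : e₀ ≡ 1
  e₀≡1 = sf-a e₀ (coprime-square-divisor {a} {b} c₀⊥e₀ eq₀)
  c₀≡1 : c₀ ≡ 1
  c₀≡1 = sf-b c₀ (coprime-square-divisor {b} {a} (ℕC.sym c₀⊥e₀) (sym eq₀))

3-prime : Prime 3
3-prime = from-yes (prime? 3)

prime⇒squareFree : ∀ {p} → Prime p → SquareFree p
prime⇒squareFree {p} p-prime m m*m∣p
  with prime⇒irreducible p-prime (ℕ∣.∣-trans (ℕ∣.m∣m*n m) m*m∣p)
... | inj₁ m≡1 = m≡1
... | inj₂ refl = ⊥-elim (ℕP.<⇒≱ (ℕP.m<m*n m m (ℕ.nonTrivial⇒n>1 m)) (ℕ∣.∣⇒≤ m*m∣p))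
  where
  instance
    p≢0 : ℕ.NonZero p
    p≢0 = prime⇒nonZero p-prime
    p>1 : ℕ.NonTrivial p
    p>1 = prime⇒nonTrivial p-prime

∣n*i*i∣ : ∀ n i → ∣ + n * (i * i) ∣ ≡ n ℕ.* (∣ i ∣ ℕ.* ∣ i ∣)
∣n*i*i∣ n i = trans (ℤP.abs-* (+ n) (i * i)) (cong (n ℕ.*_) (ℤP.abs-* i i))

hexBasis⇒d≡3 : ∀ {d I u v} → SquareFree d → IsBasis d I u v
  → inner d u u ≡ inner d v v → inner d u u ≡ + 2 * inner d u v → d ≡ 3
hexBasis⇒d≡3 {d} {I} {u@(x , y)} {v@(x' , y')} sf-d (_ , _ , δ≢0 , _) |u|≡|v| |u|≡2⟨u,v⟩
  with disc≡d*square d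
... | k , k≢0 , disc≡ =
  sym (squareFree-unique ∣ c ∣ (prime⇒squareFree 3-prime) sf-d kδ≢0 (begin
    3 ℕ.* (∣ c ∣ ℕ.* ∣ c ∣)                  ≡⟨ ∣n*i*i∣ 3 c ⟨
    ∣ + 3 * (c * c) ∣                         ≡⟨ cong ∣_∣ 3c²≡Dδ² ⟩
    ∣ + D * (δ * δ) ∣                         ≡⟨ ∣n*i*i∣ D δ ⟩
    D ℕ.* (∣ δ ∣ ℕ.* ∣ δ ∣)                  ≡⟨ regroup d k ∣ δ ∣ ⟩
    d ℕ.* ((k ℕ.* ∣ δ ∣) ℕ.* (k ℕ.* ∣ δ ∣)) ∎))
  where
  open ≡-Reasoning
  c δ : ℤ
  c = inner d u v
  δ = detO u v
  D : ℕ
  D = d ℕ.* (k ℕ.* k)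
  3c²≡Dδ² : + 3 * (c * c) ≡ + D * (δ * δ)
  3c²≡Dδ² = begin
    + 3 * (c * c)                     ≡⟨ hexGram-det |u|≡|v| |u|≡2⟨u,v⟩ ⟩
    inner d u u * inner d v v - c * c ≡⟨ 𝒪.gram-det d x y x' y' ⟩
    𝒪.disc d * (δ * δ)                ≡⟨ cong (_* (δ * δ)) disc≡ ⟩
    + D * (δ * δ)                     ∎
  kδ≢0 : k ℕ.* ∣ δ ∣ ≢ 0
  kδ≢0 kδ≡0 = [ k≢0 , (λ |δ|≡0 → δ≢0 (ℤP.∣i∣≡0⇒i≡0 |δ|≡0)) ]′ (ℕP.m*n≡0⇒m≡0∨n≡0 k kδ≡0)
  regroup : ∀ d k x → d ℕ.* (k ℕ.* k) ℕ.* (x ℕ.* x) ≡ d ℕ.* ((k ℕ.* x) ℕ.* (k ℕ.* x))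
  regroup = ℕSolver.solve-∀

-- The ideals (2, 1 + √3) and (6, 3 + √3) of ℤ[√3]

inner₃ : ∀ x y x' y' → inner 3 (x , y) (x' , y') ≡ + 2 * (x * x' + + 3 * (y * y'))
inner₃ x y x' y' = ℤP.+-identityʳ _

ω-closed : ∀ {I} → IsIdeal 3 I → ∀ {x y} → I (x , y) → I (+ 3 * y , x)
ω-closed {I} isI {x} {y} Iw = transport I (IsIdeal.mul-closed isI (0ℤ , 1ℤ) (x , y) Iw) (begin
  (0ℤ * x + + 3 * (1ℤ * y) , 0ℤ * y + x * 1ℤ + 0ℤ * (1ℤ * y)) ≡⟨ cong₂ _,_ (solve vs) (solve vs) ⟩
  (+ 3 * y , x)                                               ∎)
  where
  open ≡-Reasoning
  vs : List ℤ
  vs = x ∷ y ∷ []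

J₁-span : Span J₁ (+ 2 , 0ℤ) (1ℤ , 1ℤ)
J₁-span _ ((r , r') , (s , s') , refl) = r - r' + s' , + 2 * r' + s + s' , (begin
  (r * + 2 + + 3 * (r' * 0ℤ) + (s * 1ℤ + + 3 * (s' * 1ℤ)) ,
   r * 0ℤ + + 2 * r' + 0ℤ * (r' * 0ℤ) + (s * 1ℤ + 1ℤ * s' + 0ℤ * (s' * 1ℤ)))
    ≡⟨ cong₂ _,_ (solve vs) (solve vs) ⟩
  lin (r - r' + s') (+ 2 , 0ℤ) (+ 2 * r' + s + s') (1ℤ , 1ℤ) ∎)
  where
  open ≡-Reasoning
  vs : List ℤ
  vs = r ∷ r' ∷ s ∷ s' ∷ []

J₂-span : Span J₂ (+ 3 , 1ℤ) (0ℤ , + 2)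
J₂-span _ ((r , r') , (s , s') , refl) = + 2 * r + s + s' , + 3 * r' - r + s' , (begin
  (r * + 6 + + 3 * (r' * 0ℤ) + (s * + 3 + + 3 * (s' * 1ℤ)) ,
   r * 0ℤ + + 6 * r' + 0ℤ * (r' * 0ℤ) + (s * 1ℤ + + 3 * s' + 0ℤ * (s' * 1ℤ)))
    ≡⟨ cong₂ _,_ (solve vs) (solve vs) ⟩
  lin (+ 2 * r + s + s') (+ 3 , 1ℤ) (+ 3 * r' - r + s') (0ℤ , + 2) ∎)
  where
  open ≡-Reasoning
  vs : List ℤ
  vs = r ∷ r' ∷ s ∷ s' ∷ []

J₁-basis : IsBasis 3 J₁ (+ 2 , 0ℤ) (1ℤ , 1ℤ)
J₁-basis = ((1ℤ , 0ℤ) , zeroO , refl) , (zeroO , (1ℤ , 0ℤ) , refl) , (λ ()) , J₁-span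

J₂-basis : IsBasis 3 J₂ (+ 3 , 1ℤ) (0ℤ , + 2)
J₂-basis = (zeroO , (1ℤ , 0ℤ) , refl) , ((- 1ℤ , 0ℤ) , (+ 2 , 0ℤ) , refl) , (λ ()) , J₂-span

J₁-good : Good 3 J₁
J₁-good = Gen2-isIdeal 3 _ _ , ∋[x,1]⇒primitive {I = J₁} (proj₁ (proj₂ J₁-basis)) ,
          (Gen2-principal 3 _ _ (- 1ℤ , 1ℤ) refl , similarToHex⇒wellRounded {3} {J₁} J₁-hex) , J₁-hex
  where
  J₁-hex : SimilarToHex 3 J₁
  J₁-hex = (+ 2 , 0ℤ) , (1ℤ , 1ℤ) , J₁-basis , refl , refl

J₂-good : Good 3 J₂
J₂-good = Gen2-isIdeal 3 _ _ , ∋[x,1]⇒primitive {I = J₂} (proj₁ J₂-basis) ,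
          (Gen2-principal 3 _ _ (+ 3 , - 1ℤ) refl , similarToHex⇒wellRounded {3} {J₂} J₂-hex) , J₂-hex
  where
  J₂-hex : SimilarToHex 3 J₂
  J₂-hex = (+ 3 , 1ℤ) , (0ℤ , + 2) , J₂-basis , refl , refl

-- 1 + √3 ∈ J₁, whereas first coordinates of elements of J₂ are multiples of 3.
J₁≉J₂ : ¬ (J₁ ≈ˢ J₂)
J₁≉J₂ J₁≈J₂ = not-in-J₂ (J₂-span _ (Equivalence.to (J₁≈J₂ _) (proj₁ (proj₂ J₁-basis))))
  where
  not-in-J₂ : ¬ (∃[ m ] ∃[ n ] (1ℤ , 1ℤ) ≡ (m * + 3 + n * 0ℤ , m * 1ℤ + n * + 2))
  not-in-J₂ (m , n , 1+√3≡) = m*n≢1 {+ 3} {m} (+≤+ (s≤s (s≤s z≤n)))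
    (linear-combination (- 1ℤ) (,-injectiveˡ 1+√3≡) (solve (m ∷ n ∷ [])))

-- Hexagonal bases of ideals of ℤ[√3]

IsBasis-swap : ∀ {d I x y x' y'} → IsBasis d I (x , y) (x' , y') → IsBasis d I (x' , y') (x , y)
IsBasis-swap {d} {I} {x} {y} {x'} {y'} (Iu , Iv , δ≢0 , span) =
  Iv , Iu , (λ δ'≡0 → δ≢0 (δ≡0 δ'≡0)) , λ α Iα → swap (span α Iα)
  where
  δ≡0 : x' * y - x * y' ≡ 0ℤ → x * y' - x' * y ≡ 0ℤ
  δ≡0 δ'≡0 = linear-combination (- 1ℤ) δ'≡0 (solve (x ∷ y ∷ x' ∷ y' ∷ []))
  swap : ∀ {α} → ∃[ m ] ∃[ n ] α ≡ lin m (x , y) n (x' , y')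
       → ∃[ n ] ∃[ m ] α ≡ lin n (x' , y') m (x , y)
  swap (m , n , refl) = n , m , cong₂ _,_ (solve vs) (solve vs)
    where
      vs : List ℤ
      vs = m ∷ n ∷ x ∷ y ∷ x' ∷ y' ∷ []

-- With A = x² + 3y², C = x x' + 3 y y' and δ = det(u, v), the hypotheses say A = 2C
-- and C = δ ≠ 0; multiplied by C, the claims become combinations of A - 2C and C - δ.
hexBasis-shape : ∀ {I x y x' y'} → IsBasis 3 I (x , y) (x' , y')
  → x * x + + 3 * (y * y) ≡ + 2 * (x * x' + + 3 * (y * y'))
  → x * x' + + 3 * (y * y') ≡ x * y' - x' * y
  → IsBasis 3 I (+ 2 * y' - y , y) (y' - + 2 * y , y')
hexBasis-shape {I} {x} {y} {x'} {y'} basis@(_ , _ , δ≢0 , _) A≡2C C≡δ =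
  subst₂ (IsBasis 3 I) (cong (_, y) x≡2y'-y) (cong (_, y') x'≡y'-2y) basis
  where
  vs : List ℤ
  vs = x ∷ y ∷ x' ∷ y' ∷ []
  instance
    C≢0 : ℤ.NonZero (x * x' + + 3 * (y * y'))
    C≢0 = ℤ.≢-nonZero (λ C≡0 → δ≢0 (trans (sym C≡δ) C≡0))
  2y'≡x+y : + 2 * y' ≡ x + y
  2y'≡x+y = ℤP.*-cancelˡ-≡ (x * x' + + 3 * (y * y')) _ _
    (linear-combination (- x) C≡δ (linear-combination (- y') A≡2C (solve vs)))
  2x'≡x-3y : + 2 * x' ≡ x - + 3 * y
  2x'≡x-3y = ℤP.*-cancelˡ-≡ (x * x' + + 3 * (y * y')) _ _
    (linear-combination (+ 3 * y) C≡δ (linear-combination (- x') A≡2C (solve vs)))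
  x≡2y'-y : x ≡ + 2 * y' - y
  x≡2y'-y = linear-combination (- 1ℤ) 2y'≡x+y (solve vs)
  x'≡y'-2y : x' ≡ y' - + 2 * y
  x'≡y'-2y = ℤP.*-cancelˡ-≡ (+ 2) _ _
    (linear-combination 1ℤ 2x'≡x-3y (linear-combination (- 1ℤ) 2y'≡x+y (solve vs)))

-- hexGram-det and the Gram determinant A B - C² = 3 δ² give C = ± δ; the sign is the
-- orientation of (u, v), which swapping u and v reverses.
hexBasis⇒hexPair : ∀ {I u v} → IsBasis 3 I u v
  → inner 3 u u ≡ inner 3 v v → inner 3 u u ≡ + 2 * inner 3 u v
  → ∃[ b ] ∃[ e ] IsBasis 3 I (+ 2 * e - b , b) (e - + 2 * b , e)
hexBasis⇒hexPair {I} {x , y} {x' , y'} basis |u|≡|v| |u|≡2⟨u,v⟩ =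
  [ positive , negative ]′ (ℤP.i*j≡0⇒i≡0∨j≡0 _ [C-δ][C+δ]≡0)
  where
  open ≡-Reasoning
  vs : List ℤ
  vs = x ∷ y ∷ x' ∷ y' ∷ []
  A≡B : x * x + + 3 * (y * y) ≡ x' * x' + + 3 * (y' * y')
  A≡B = ℤP.*-cancelˡ-≡ (+ 2) _ _ (trans (sym (inner₃ x y x y)) (trans |u|≡|v| (inner₃ x' y' x' y')))
  A≡2C : x * x + + 3 * (y * y) ≡ + 2 * (x * x' + + 3 * (y * y'))
  A≡2C = ℤP.*-cancelˡ-≡ (+ 2) _ _
    (trans (sym (inner₃ x y x y)) (trans |u|≡2⟨u,v⟩ (cong (+ 2 *_) (inner₃ x y x' y'))))
  [C-δ][C+δ]≡0 : (x * x' + + 3 * (y * y') - (x * y' - x' * y))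
               * (x * x' + + 3 * (y * y') + (x * y' - x' * y)) ≡ 0ℤ
  [C-δ][C+δ]≡0 = ℤP.*-cancelˡ-≡ (+ 3) _ _ (linear-combination 1ℤ
    (hexGram-det {C = x * x' + + 3 * (y * y')} A≡B A≡2C) (solve vs))
  positive : x * x' + + 3 * (y * y') - (x * y' - x' * y) ≡ 0ℤ
           → ∃[ b ] ∃[ e ] IsBasis 3 I (+ 2 * e - b , b) (e - + 2 * b , e)
  positive C-δ≡0 = y , y' , hexBasis-shape basis A≡2C (linear-combination 1ℤ C-δ≡0 (solve vs))
  negative : x * x' + + 3 * (y * y') + (x * y' - x' * y) ≡ 0ℤ
           → ∃[ b ] ∃[ e ] IsBasis 3 I (+ 2 * e - b , b) (e - + 2 * b , e)
  negative C+δ≡0 = y' , y , hexBasis-shape (IsBasis-swap {3} {I} basis)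
    (linear-combination (- 1ℤ) A≡B (linear-combination 1ℤ A≡2C (solve vs)))
    (linear-combination 1ℤ C+δ≡0 (solve vs))

span-detO-∣ : ∀ {I u v w w'} → Span I u v → I w → I w' → detO u v ∣ detO w w'
span-detO-∣ {u = x , y} {x' , y'} {w} {w'} span Iw Iw' = det-of-lins (span w Iw) (span w' Iw')
  where
  det-of-lins : ∀ {w w'} → ∃[ m ] ∃[ n ] w ≡ lin m (x , y) n (x' , y')
    → ∃[ m ] ∃[ n ] w' ≡ lin m (x , y) n (x' , y') → detO (x , y) (x' , y') ∣ detO w w'
  det-of-lins (m , n , refl) (m' , n' , refl) = divides (m * n' - m' * n) (begin
    (m * x + n * x') * (m' * y + n' * y') - (m' * x + n' * x') * (m * y + n * y')
      ≡⟨ solve (m ∷ n ∷ m' ∷ n' ∷ x ∷ y ∷ x' ∷ y' ∷ []) ⟩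
    (m * n' - m' * n) * (x * y' - x' * y) ∎)
    where open ≡-Reasoning

∣-of-cofactor : ∀ {n x z} k → + 2 * n ∣ x → x ≡ + 2 * (k * n - z) → n ∣ z
∣-of-cofactor {n} {x} {z} k (divides q x≡q2n) x≡ = divides (k - q) (ℤP.*-cancelˡ-≡ (+ 2) _ _
  (linear-combination 1ℤ x≡ (linear-combination (- 1ℤ) x≡q2n (solve (n ∷ x ∷ z ∷ k ∷ q ∷ [])))))

coprime-factors : ∀ {b e n o} → Coprime b e → n ∣ b * o → n ∣ e * o → n ∣ o
coprime-factors {b} {e} {n} {o} b⊥e n∣bo n∣eo =
  ∣ᵤ⇒∣ {n} {o} (ℕC.coprime-factors b⊥e (unsigned {b} n∣bo , unsigned {e} n∣eo))
  where
  unsigned : ∀ {c} → n ∣ c * o → ∣ n ∣ ℕ∣.∣ ∣ c ∣ ℕ.* ∣ o ∣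
  unsigned {c} n∣co = subst (∣ n ∣ ℕ∣.∣_) (ℤP.abs-* c o) (∣⇒∣ᵤ {n} {c * o} n∣co)

coprime⇒∣-of-square-multiples : ∀ {b e n k} → Coprime b e
  → n ∣ k * (b * b) → n ∣ k * (b * e) → n ∣ k * (e * e) → n ∣ k
coprime⇒∣-of-square-multiples {b} {e} {n} {k} b⊥e n∣kbb n∣kbe n∣kee =
  coprime-factors {b} {e} b⊥e (transport (n ∣_) n∣kb (solve vs)) (transport (n ∣_) n∣ke (solve vs))
  where
  vs : List ℤ
  vs = b ∷ e ∷ k ∷ []
  n∣kb : n ∣ k * b
  n∣kb = coprime-factors {b} {e} b⊥e (transport (n ∣_) n∣kbb (solve vs)) (transport (n ∣_) n∣kbe (solve vs))
  n∣ke : n ∣ k * e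
  n∣ke = coprime-factors {b} {e} b⊥e (transport (n ∣_) n∣kbe (solve vs)) (transport (n ∣_) n∣kee (solve vs))

common-factor⇒multiples : ∀ {I b e g} → g ∣ b → g ∣ e → Span I (+ 2 * e - b , b) (e - + 2 * b , e)
  → ∀ α → I α → ∃[ β ] α ≡ scaleO g β
common-factor⇒multiples {I} {g = g} (divides b₀ refl) (divides e₀ refl) span α Iα =
  factor (span α Iα)
  where
  factor : ∀ {α} → ∃[ m ] ∃[ n ] α ≡ lin m (+ 2 * (e₀ * g) - b₀ * g , b₀ * g) n (e₀ * g - + 2 * (b₀ * g) , e₀ * g)
         → ∃[ β ] α ≡ scaleO g β
  factor (m , n , refl) = _ , (begin
    lin m (+ 2 * (e₀ * g) - b₀ * g , b₀ * g) n (e₀ * g - + 2 * (b₀ * g) , e₀ * g)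
      ≡⟨ cong₂ _,_ (solve vs) (solve vs) ⟩
    scaleO g (m * (+ 2 * e₀ - b₀) + n * (e₀ - + 2 * b₀) , m * b₀ + n * e₀) ∎)
    where
    open ≡-Reasoning
    vs : List ℤ
    vs = m ∷ n ∷ b₀ ∷ e₀ ∷ g ∷ []

primitive⇒coprime : ∀ {d I b e} → IsIdeal d I → Primitive d I
  → IsBasis d I (+ 2 * e - b , b) (e - + 2 * b , e) → Coprime b e
primitive⇒coprime {d} {I} {b} {e} isI I-prim (_ , _ , δ≢0 , span) = common-divisor≡1
  where
  common-divisor≡1 : ∀ {i} → i ℕ∣.∣ ∣ b ∣ × i ℕ∣.∣ ∣ e ∣ → i ≡ 1
  common-divisor≡1 {zero} (0∣b , 0∣e) = ⊥-elim (δ≢0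
    (subst₂ (λ b e → detO (+ 2 * e - b , b) (e - + 2 * b , e) ≡ 0ℤ)
      (sym (ℤP.∣i∣≡0⇒i≡0 {b} (ℕ∣.0∣⇒≡0 0∣b))) (sym (ℤP.∣i∣≡0⇒i≡0 {e} (ℕ∣.0∣⇒≡0 0∣e))) refl))
  common-divisor≡1 {suc zero} _ = refl
  common-divisor≡1 {i@(suc (suc _))} (i∣b , i∣e) =
    ⊥-elim (multiples⇒¬primitive {m = + i} isI (+≤+ (s≤s (s≤s z≤n)))
      (common-factor⇒multiples {I} (∣ᵤ⇒∣ {+ i} {b} i∣b) (∣ᵤ⇒∣ {+ i} {e} i∣e) span) I-prim)

nonNeg∣prime : ∀ {p n} → Prime p → 0ℤ ℤ.≤ n → n ∣ + p → n ≡ 1ℤ ⊎ n ≡ + p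
nonNeg∣prime {p} {+ k} p-prime _ k∣p with prime⇒irreducible p-prime (∣⇒∣ᵤ {+ k} {+ p} k∣p)
... | inj₁ refl = inj₁ refl
... | inj₂ refl = inj₂ refl

prime∣square⇒∣ : ∀ {p i} → Prime p → + p ∣ i * i → + p ∣ i
prime∣square⇒∣ {p} {i} p-prime p∣i*i = ∣ᵤ⇒∣ {+ p} {i} ([ id , id ]′
  (euclidsLemma ∣ i ∣ ∣ i ∣ p-prime (subst (p ℕ∣.∣_) (ℤP.abs-* i i) (∣⇒∣ᵤ {+ p} {i * i} p∣i*i))))

-- With N = hexForm b (- e): det(u, v) = 2N, and for w, w' ∈ {u, v} with √3-coordinates
-- y, y', det(w, √3 w') = 2 (k N - 3 y y') lies in det(u, v) ℤ because w, √3 w' ∈ I.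
hexPair-norm∣3 : ∀ {I b e} → IsIdeal 3 I → Primitive 3 I
  → IsBasis 3 I (+ 2 * e - b , b) (e - + 2 * b , e) → hexForm b (- e) ∣ + 3
hexPair-norm∣3 {I} {b} {e} isI I-prim basis@(Iu , Iv , _ , span) =
  coprime⇒∣-of-square-multiples {b} {e} (primitive⇒coprime isI I-prim basis)
    (∣-of-cofactor (+ 2) (2N∣det Iu (ω-closed isI Iu)) (begin
      (+ 2 * e - b) * (+ 2 * e - b) - + 3 * b * b        ≡⟨ solve vs ⟩
      + 2 * (+ 2 * (b * b + b * - e + - e * - e) - + 3 * (b * b))                    ∎))
    (∣-of-cofactor 1ℤ (2N∣det Iu (ω-closed isI Iv)) (begin
      (+ 2 * e - b) * (e - + 2 * b) - + 3 * e * b        ≡⟨ solve vs ⟩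
      + 2 * (1ℤ * (b * b + b * - e + - e * - e) - + 3 * (b * e))                     ∎))
    (∣-of-cofactor (+ 2) (2N∣det Iv (ω-closed isI Iv)) (begin
      (e - + 2 * b) * (e - + 2 * b) - + 3 * e * e        ≡⟨ solve vs ⟩
      + 2 * (+ 2 * (b * b + b * - e + - e * - e) - + 3 * (e * e))                    ∎))
  where
  open ≡-Reasoning
  vs : List ℤ
  vs = b ∷ e ∷ []
  2N∣det : ∀ {w w'} → I w → I w' → + 2 * hexForm b (- e) ∣ detO w w'
  2N∣det {w} {w'} Iw Iw' = transport (_∣ detO w w') (span-detO-∣ {I} span Iw Iw') (begin
    (+ 2 * e - b) * e - (e - + 2 * b) * b ≡⟨ solve vs ⟩
    + 2 * (b * b + b * - e + - e * - e)   ∎)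

-- e u - b v = (2N , 0) and b u + (e - b) v = (N , N).
hexPair≈J₁ : ∀ {I b e} → IsIdeal 3 I → IsBasis 3 I (+ 2 * e - b , b) (e - + 2 * b , e)
  → hexForm b (- e) ≡ 1ℤ → I ≈ˢ J₁
hexPair≈J₁ {I} {b} {e} isI (Iu , Iv , _ , span) N≡1 = ⊆ˢ-antisym
  (span⊆ideal J₁-isIdeal {u = (+ 2 * e - b , b)} {(e - + 2 * b , e)} span
    (transport J₁ {y = (+ 2 * e - b , b)} (ideal-lin J₁-isIdeal (e - b) b J₁∋2 J₁∋1+√3)
      (cong₂ _,_ (solve vs) (solve vs)))
    (transport J₁ {y = (e - + 2 * b , e)} (ideal-lin J₁-isIdeal (- b) e J₁∋2 J₁∋1+√3)
      (cong₂ _,_ (solve vs) (solve vs))))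
  (span⊆ideal isI {u = (+ 2 , 0ℤ)} {(1ℤ , 1ℤ)} J₁-span
    (transport I (ideal-lin isI e (- b) Iu Iv)
      (cong₂ _,_ (linear-combination (+ 2) N≡1′ (solve vs)) (solve vs)))
    (transport I (ideal-lin isI b (e - b) Iu Iv)
      (cong₂ _,_ (linear-combination 1ℤ N≡1′ (solve vs)) (linear-combination 1ℤ N≡1′ (solve vs)))))
  where
  vs : List ℤ
  vs = b ∷ e ∷ []
  N≡1′ : b * b + b * - e + - e * - e ≡ 1ℤ
  N≡1′ = N≡1
  J₁-isIdeal : IsIdeal 3 J₁
  J₁-isIdeal = Gen2-isIdeal 3 _ _
  J₁∋2 : J₁ (+ 2 , 0ℤ)
  J₁∋2 = proj₁ J₁-basis
  J₁∋1+√3 : J₁ (1ℤ , 1ℤ)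
  J₁∋1+√3 = proj₁ (proj₂ J₁-basis)

-- Now 3 ∣ (b + e)² = N + 3 b e, so b + e = 3 t; then t u + (t - b) v = (3 , 1) and
-- (2 t - e) u + (2 t - b) v = (0 , 2).
hexPair≈J₂ : ∀ {I b e} → IsIdeal 3 I → IsBasis 3 I (+ 2 * e - b , b) (e - + 2 * b , e)
  → hexForm b (- e) ≡ + 3 → I ≈ˢ J₂
hexPair≈J₂ {I} {b} {e} isI (Iu , Iv , _ , span) N≡3 =
  from-thirds (prime∣square⇒∣ 3-prime (divides (1ℤ + b * e) (linear-combination 1ℤ N≡3′ (solve (b ∷ e ∷ [])))))
  where
  N≡3′ : b * b + b * - e + - e * - e ≡ + 3
  N≡3′ = N≡3
  J₂-isIdeal : IsIdeal 3 J₂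
  J₂-isIdeal = Gen2-isIdeal 3 _ _
  J₂∋3+√3 : J₂ (+ 3 , 1ℤ)
  J₂∋3+√3 = proj₁ J₂-basis
  J₂∋2√3 : J₂ (0ℤ , + 2)
  J₂∋2√3 = proj₁ (proj₂ J₂-basis)
  from-thirds : + 3 ∣ b + e → I ≈ˢ J₂
  from-thirds (divides t b+e≡3t) = ⊆ˢ-antisym
    (span⊆ideal J₂-isIdeal {u = (+ 2 * e - b , b)} {(e - + 2 * b , e)} span
      (transport J₂ {y = (+ 2 * e - b , b)} (ideal-lin J₂-isIdeal (+ 2 * t - b) (b - t) J₂∋3+√3 J₂∋2√3)
        (cong₂ _,_ (linear-combination (- (+ 2)) b+e≡3t (solve vs)) (solve vs)))
      (transport J₂ {y = (e - + 2 * b , e)} (ideal-lin J₂-isIdeal (t - b) t J₂∋3+√3 J₂∋2√3)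
        (cong₂ _,_ (linear-combination (- 1ℤ) b+e≡3t (solve vs))
                   (linear-combination (- 1ℤ) b+e≡3t (solve vs)))))
    (span⊆ideal isI {u = (+ 3 , 1ℤ)} {(0ℤ , + 2)} J₂-span
      (transport I (ideal-lin isI t (t - b) Iu Iv)
        (cong₂ _,_ (linear-combination 1ℤ N≡3′ (linear-combination (b - e) b+e≡3t (solve vs))) M≡1))
      (transport I (ideal-lin isI (+ 2 * t - e) (+ 2 * t - b) Iu Iv)
        (cong₂ _,_ (linear-combination (+ 2 * (b - e)) b+e≡3t (solve vs))
                   (linear-combination (+ 2) M≡1 (solve vs)))))
    where
    vs : List ℤ
    vs = b ∷ e ∷ t ∷ []
    M≡1 : t * b + (t - b) * e ≡ 1ℤ
    M≡1 = ℤP.*-cancelˡ-≡ (+ 3) _ _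
      (linear-combination 1ℤ N≡3′ (linear-combination (- (b + e)) b+e≡3t (solve vs)))

hexPair-classification : ∀ {I b e} → IsIdeal 3 I → Primitive 3 I
  → IsBasis 3 I (+ 2 * e - b , b) (e - + 2 * b , e) → I ≈ˢ J₁ ⊎ I ≈ˢ J₂
hexPair-classification {b = b} {e} isI I-prim basis =
  [ (λ N≡1 → inj₁ (hexPair≈J₁ isI basis N≡1)) , (λ N≡3 → inj₂ (hexPair≈J₂ isI basis N≡3)) ]′
    (nonNeg∣prime 3-prime (hexForm-nonNeg b (- e)) (hexPair-norm∣3 isI I-prim basis))

good₃-classification : ∀ {I} → Good 3 I → I ≈ˢ J₁ ⊎ I ≈ˢ J₂
good₃-classification (isI , I-prim , _ , _ , _ , basis , |u|≡|v| , |u|≡2⟨u,v⟩) =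
  hexPair-classification isI I-prim (proj₂ (proj₂ (hexBasis⇒hexPair basis |u|≡|v| |u|≡2⟨u,v⟩)))

corollary5p11 :
    (Good 3 J₁ × Good 3 J₂ × ¬ (J₁ ≈ˢ J₂))
    × (∀ (d : ℕ) → 1 < d → SquareFree d → ∀ (I : Subset) → Good d I
         → d ≡ 3 × (I ≈ˢ J₁ ⊎ I ≈ˢ J₂))
corollary5p11 = (J₁-good , J₂-good , J₁≉J₂) , classification
  where
  classification : ∀ d → 1 < d → SquareFree d → ∀ I → Good d I → d ≡ 3 × (I ≈ˢ J₁ ⊎ I ≈ˢ J₂)
  classification d _ sf-d I good@(_ , _ , _ , _ , _ , basis , |u|≡|v| , |u|≡2⟨u,v⟩) =
    d≡3 , good₃-classification (subst (λ d → Good d I) d≡3 good)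
    where
    d≡3 : d ≡ 3
    d≡3 = hexBasis⇒d≡3 sf-d basis |u|≡|v| |u|≡2⟨u,v⟩
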